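{- Let $\sigma\in K_n$ and let $1\leq j<i\leq n$. If $\nabla_j(\nabla_i(\sigma))\in K_{n-2}$ but $\nabla_i(\sigma)\notin K_{n-1}$ and $\nabla_j(\sigma)\notin K_{n-1}$, then $\sigma_i$ separates $\sigma_j$ from some element of $\sigma$, and $\sigma_j$ separates $\sigma_i$ from some element of $\sigma$.
   Context: Permutations are written in one-line notation $\sigma=[\sigma_1,\dots,\sigma_n]$. $K_n$ is the set of $\sigma\in S_n$ with $|\sigma_i-\sigma_{i-1}|\neq1$ for all $2\le i\le n$ (king permutations). For $\pi\in S_n$ and $1\le i\le n$, $\nabla_i(\pi)\in S_{n-1}$ is obtained by deleting the $i$-th entry of $\pi$ and standardizing the remaining entries (each remaining entry larger than $\pi_i$ is decreased by $1$). A $2$-block of a permutation is a pair of adjacent positions whose values are consecutive integers. For $\sigma\in S_n$, the entry $\sigma_i=a$ separates $\sigma_{j_1}$ from $\sigma_{j_2}$ if deleting $a$ produces a new $2$-block, which happens exactly when either (vertical separator) $j_1,i,j_2$ are consecutive positions and $|\sigma_{j_1}-\sigma_{j_2}|=1$, i.e. $\sigma=[\dots,b,a,b\pm1,\dots]$; or (horizontal separator) $\sigma_{j_1},a,\sigma_{j_2}$ are consecutive integers and $|j_1-j_2|=1$, i.e. $\sigma=[\dots,a,\dots,a\pm1,a\mp1,\dots]$ or $\sigma=[\dots,a\pm1,a\mp1,\dots,a,\dots]$. -}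

module Defs where

open import Data.Nat using (ℕ; zero; suc; _∸_; _<ᵇ_; _≤_)
open import Data.Bool using (if_then_else_)
open import Data.List using (List; []; _∷_; map; upTo; length)
open import Data.List.Relation.Binary.Permutation.Propositional using (_↭_)
open import Data.Product using (_×_; Σ)
open import Data.Sum using (_⊎_)
open import Relation.Binary.PropositionalEquality using (_≡_)
open import Relation.Nullary using (¬_)

IsPerm : ℕ → List ℕ → Set
IsPerm n σ = σ ↭ map suc (upTo n)

Adj : ℕ → ℕ → Set
Adj a b = (suc a ≡ b) ⊎ (suc b ≡ a)

IsKing : List ℕ → Set
IsKing [] = Data.Unit.⊤ where import Data.Unit
IsKing (a ∷ []) = Data.Unit.⊤ where import Data.Unit
IsKing (a ∷ b ∷ rest) = ¬ Adj a b × IsKing (b ∷ rest)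

InK : ℕ → List ℕ → Set
InK n σ = IsPerm n σ × IsKing σ

-- 1-indexed entry σ_p (only used for 1 ≤ p ≤ length σ; default 0 otherwise)
at : List ℕ → ℕ → ℕ
at [] p = 0
at (x ∷ xs) zero = 0
at (x ∷ xs) (suc zero) = x
at (x ∷ xs) (suc (suc p)) = at xs (suc p)

removeAt : List ℕ → ℕ → List ℕ
removeAt [] p = []
removeAt (x ∷ xs) zero = x ∷ xs
removeAt (x ∷ xs) (suc zero) = xs
removeAt (x ∷ xs) (suc (suc p)) = x ∷ removeAt xs (suc p)

standardize : ℕ → List ℕ → List ℕ
standardize a = map (λ x → if a <ᵇ x then x ∸ 1 else x)

nabla : ℕ → List ℕ → List ℕ
nabla p π = standardize (at π p) (removeAt π p)

ValidPos : List ℕ → ℕ → Set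
ValidPos σ p = (1 ≤ p) × (p ≤ length σ)

Separates : List ℕ → ℕ → ℕ → ℕ → Set
Separates σ i j₁ j₂ =
  ( ((suc j₁ ≡ i × suc i ≡ j₂) ⊎ (suc j₂ ≡ i × suc i ≡ j₁))
    × Adj (at σ j₁) (at σ j₂) )
  ⊎
  ( ((suc (at σ j₁) ≡ at σ i × suc (at σ i) ≡ at σ j₂)
      ⊎ (suc (at σ j₂) ≡ at σ i × suc (at σ i) ≡ at σ j₁))
    × Adj j₁ j₂ )

SeparatesFromSome : List ℕ → ℕ → ℕ → Set
SeparatesFromSome σ i j = Σ ℕ (λ k → ValidPos σ k × Separates σ i j k)

module Submission where

-- Since ∇ᵢσ is not king it contains a 2-block, and since ∇ⱼ∇ᵢσ is king, deleting position j
-- of ∇ᵢσ must destroy it: deleting an entry outside a 2-block, whose value differs from the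
-- block's values, leaves a 2-block after standardisation. So j is a position of the block.
-- Pulled back to σ, the two entries of the block are not a 2-block there (σ is king), so
-- either they sit on both sides of σᵢ with consecutive values, or they are adjacent and
-- form three consecutive values together with σᵢ: σᵢ separates them. The second claim is
-- the same argument with the roles of i and j exchanged, as ∇_{i-1}∇ⱼσ = ∇ⱼ∇ᵢσ.

open import Defs
open import Data.Nat using (ℕ; zero; suc; _+_; _∸_; _<ᵇ_; _≤_; _<_; z≤n; s≤s; z<s; _≟_)
open import Data.Nat.Properties
open import Data.Bool using (true; false; if_then_else_)
open import Data.Product using (_×_; _,_; ∃; proj₁; proj₂; uncurry)
open import Relation.Binary.PropositionalEquality
  using (_≡_; _≢_; ≢-sym; refl; sym; trans; cong; cong₂; subst; subst₂; module ≡-Reasoning; setoid)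
open import Data.List using (List; []; _∷_; _++_; map; length; upTo; applyUpTo)
open import Data.List.Properties using (length-map; length-upTo; map-∘; map-cong; map-++; map-upTo)
open import Data.List.Membership.Propositional using (_∈_)
open import Data.List.Relation.Unary.Any using (here; there)
open import Data.List.Relation.Binary.Permutation.Propositional
  using (_↭_; prep; swap; ↭-refl; ↭-reflexive; ↭-sym; ↭-trans; ↭⇒↭ₛ
        ; module PermutationReasoning)
open import Data.List.Relation.Binary.Permutation.Propositional.Properties
  using (map⁺; drop-mid; ∈-resp-↭; ↭-length)
open import Data.List.Relation.Binary.Permutation.Setoid.Properties (setoid ℕ) using (Unique-resp-↭)
open import Data.List.Relation.Unary.All as All using (All)
open import Data.List.Relation.Unary.AllPairs using (_∷_)
open import Data.List.Relation.Unary.Unique.Propositional using (Unique)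
import Data.List.Relation.Unary.Unique.Propositional.Properties as Unique
open import Data.Sum using (_⊎_; inj₁; inj₂)
open import Relation.Binary.Definitions using (tri<; tri≈; tri>)
open import Relation.Nullary using (¬_; Dec; yes; no; contradiction)
open import Relation.Nullary.Decidable using (_⊎-dec_)
open import Relation.Nullary.Reflects using (ofʸ; ofⁿ)

-- standardize v ≡ map (std v) holds definitionally.
std : ℕ → ℕ → ℕ
std v x = if v <ᵇ x then x ∸ 1 else x

data StdView (v : ℕ) : ℕ → Set where
  below : ∀ {x} → x ≤ v → std v x ≡ x → StdView v x
  above : ∀ {x} → v ≤ x → std v (suc x) ≡ x → StdView v (suc x)

stdView : ∀ v x → StdView v x
stdView v x with v <ᵇ x in eq | <ᵇ-reflects-< v x
stdView v (suc x) | true  | ofʸ v<1+x = above (≤-pred v<1+x) (cong (if_then x else suc x) eq)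
stdView v x       | false | ofⁿ v≮x   = below (≮⇒≥ v≮x) (cong (if_then x ∸ 1 else x) eq)

std-≤ : ∀ {v x} → x ≤ v → std v x ≡ x
std-≤ {v} {x} x≤v with stdView v x
... | below _ e = e
... | above v≤x' _ = contradiction (≤-trans (s≤s v≤x') x≤v) (n≮n v)

std-suc : ∀ {v x} → v ≤ x → std v (suc x) ≡ x
std-suc {v} {x} v≤x with stdView v (suc x)
... | below 1+x≤v _ = contradiction (≤-trans 1+x≤v v≤x) (n≮n x)
... | above _ e = e

Adj-sym : ∀ {a b} → Adj a b → Adj b a
Adj-sym (inj₁ e) = inj₂ e
Adj-sym (inj₂ e) = inj₁ e

Adj-suc : ∀ {a b} → Adj a b → Adj (suc a) (suc b)
Adj-suc (inj₁ e) = inj₁ (cong suc e)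
Adj-suc (inj₂ e) = inj₂ (cong suc e)

Adj-pred : ∀ {a b} → Adj (suc a) (suc b) → Adj a b
Adj-pred (inj₁ e) = inj₁ (suc-injective e)
Adj-pred (inj₂ e) = inj₂ (suc-injective e)

Consecutive : ℕ → ℕ → ℕ → Set
Consecutive a v b = (suc a ≡ v × suc v ≡ b) ⊎ (suc b ≡ v × suc v ≡ a)

Adj-straddle : ∀ {a v b} → a ≤ v → a ≢ v → v ≤ b → Adj a b → suc a ≡ v × v ≡ b
Adj-straddle {a} {v} a≤v a≢v v≤b (inj₁ 1+a≡b) = 1+a≡v , trans (sym 1+a≡v) 1+a≡b
  where
  1+a≡v : suc a ≡ v
  1+a≡v = ≤-antisym (≤∧≢⇒< a≤v a≢v) (subst (_ ≤_) (sym 1+a≡b) v≤b)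
Adj-straddle a≤v a≢v v≤b (inj₂ 1+b≡a) =
  contradiction (≤-trans a≤v v≤b) (<⇒≱ (subst (_ <_) 1+b≡a ≤-refl))

std-reflects-Adj : ∀ {v a b} → a ≢ v → b ≢ v →
                   Adj (std v a) (std v b) → Adj a b ⊎ Consecutive a v b
std-reflects-Adj {v} {a} {b} a≢v b≢v adj with stdView v a | stdView v b
... | below _ ea | below _ eb rewrite ea | eb = inj₁ adj
... | above _ ea | above _ eb rewrite ea | eb = inj₁ (Adj-suc adj)
... | below a≤v ea | above v≤b eb rewrite ea | eb with Adj-straddle a≤v a≢v v≤b adj
...   | 1+a≡v , v≡b = inj₂ (inj₁ (1+a≡v , cong suc v≡b))
std-reflects-Adj a≢v b≢v adj | above v≤a ea | below b≤v eb rewrite ea | eb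
  with Adj-straddle b≤v b≢v v≤a (Adj-sym adj)
...   | 1+b≡v , v≡a = inj₂ (inj₂ (1+b≡v , cong suc v≡a))

std-preserves-Adj : ∀ {v a b} → a ≢ v → b ≢ v → Adj a b → Adj (std v a) (std v b)
std-preserves-Adj {v} {a} {b} a≢v b≢v adj with stdView v a | stdView v b
... | below _ ea | below _ eb rewrite ea | eb = adj
... | above _ ea | above _ eb rewrite ea | eb = Adj-pred adj
... | below a≤v _ | above v≤b _ =
  contradiction (proj₂ (Adj-straddle a≤v a≢v (m≤n⇒m≤1+n v≤b) adj)) (<⇒≢ (s≤s v≤b))
... | above v≤a _ | below b≤v _ =
  contradiction (proj₂ (Adj-straddle b≤v b≢v (m≤n⇒m≤1+n v≤a) (Adj-sym adj))) (<⇒≢ (s≤s v≤a))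

std-std-≤ : ∀ {v w} → v ≤ w → ∀ x → std w (std v x) ≡ std v (std (suc w) x)
std-std-≤ {v} {w} v≤w x with stdView (suc w) x
std-std-≤ {v} {w} v≤w x | below x≤1+w e rewrite e with stdView v x
... | below x≤v e′ rewrite e′ = std-≤ (≤-trans x≤v v≤w)
... | above _ e′ rewrite e′ = std-≤ (≤-pred x≤1+w)
std-std-≤ {v} {w} v≤w (suc (suc x)) | above (s≤s w≤x) e rewrite e =
  trans (cong (std w) (std-suc (≤-trans v≤w (m≤n⇒m≤1+n w≤x))))
        (trans (std-suc w≤x) (sym (std-suc (≤-trans v≤w w≤x))))

std-comm-< : ∀ {v w} → v < w → ∀ x → std (std v w) (std v x) ≡ std (std w v) (std w x)
std-comm-< {v} {suc w} (s≤s v≤w) x rewrite std-suc v≤w | std-≤ (m≤n⇒m≤1+n v≤w) =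
  std-std-≤ v≤w x

std-comm : ∀ {v w} → v ≢ w → ∀ x → std (std v w) (std v x) ≡ std (std w v) (std w x)
std-comm {v} {w} v≢w x with <-cmp v w
... | tri< v<w _ _ = std-comm-< v<w x
... | tri≈ _ v≡w _ = contradiction v≡w v≢w
... | tri> _ _ w<v = sym (std-comm-< w<v x)

at-∈ : ∀ L p → ValidPos L p → at L p ∈ L
at-∈ [] (suc p) (_ , ())
at-∈ (x ∷ L) (suc zero) _ = here refl
at-∈ (x ∷ L) (suc (suc p)) (_ , s≤s p<) = there (at-∈ L (suc p) (s≤s z≤n , p<))

removeAt-↭ : ∀ L r → ValidPos L r → L ↭ at L r ∷ removeAt L r
removeAt-↭ [] (suc r) (_ , ())
removeAt-↭ (x ∷ L) (suc zero) _ = ↭-refl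
removeAt-↭ (x ∷ L) (suc (suc r)) (_ , s≤s r<) =
  ↭-trans (prep x (removeAt-↭ L (suc r) (s≤s z≤n , r<))) (swap x _ ↭-refl)

length-removeAt : ∀ L r → ValidPos L r → length L ≡ suc (length (removeAt L r))
length-removeAt [] (suc r) (_ , ())
length-removeAt (x ∷ L) (suc zero) _ = refl
length-removeAt (x ∷ L) (suc (suc r)) (_ , s≤s r<) =
  cong suc (length-removeAt L (suc r) (s≤s z≤n , r<))

at-removeAt-< : ∀ L {r p} → 1 ≤ p → p < r → at (removeAt L r) p ≡ at L p
at-removeAt-< [] _ _ = refl
at-removeAt-< (x ∷ L) {suc zero} {suc zero} _ (s≤s ())
at-removeAt-< (x ∷ L) {suc (suc r)} {suc zero} _ _ = refl
at-removeAt-< (x ∷ L) {suc (suc r)} {suc (suc p)} _ (s≤s p<r) = at-removeAt-< L (s≤s z≤n) p<r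

at-removeAt-≥ : ∀ L {r p} → 1 ≤ r → r ≤ p → at (removeAt L r) p ≡ at L (suc p)
at-removeAt-≥ [] _ _ = refl
at-removeAt-≥ (x ∷ L) {suc zero} {suc p} _ _ = refl
at-removeAt-≥ (x ∷ L) {suc (suc r)} {suc (suc p)} _ (s≤s r≤p) = at-removeAt-≥ L (s≤s z≤n) r≤p

at-map : ∀ (g : ℕ → ℕ) → g 0 ≡ 0 → ∀ L p → at (map g L) p ≡ g (at L p)
at-map g g0≡0 [] p = sym g0≡0
at-map g g0≡0 (x ∷ L) zero = sym g0≡0
at-map g g0≡0 (x ∷ L) (suc zero) = refl
at-map g g0≡0 (x ∷ L) (suc (suc p)) = at-map g g0≡0 L (suc p)

removeAt-map : ∀ (g : ℕ → ℕ) L r → removeAt (map g L) r ≡ map g (removeAt L r)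
removeAt-map g [] r = refl
removeAt-map g (x ∷ L) zero = refl
removeAt-map g (x ∷ L) (suc zero) = refl
removeAt-map g (x ∷ L) (suc (suc r)) = cong (g x ∷_) (removeAt-map g L (suc r))

removeAt-removeAt : ∀ L {i j} → 1 ≤ j → j ≤ i →
                    removeAt (removeAt L (suc i)) j ≡ removeAt (removeAt L j) i
removeAt-removeAt [] _ _ = refl
removeAt-removeAt (x ∷ L) {suc i} {suc zero} _ _ = refl
removeAt-removeAt (x ∷ L) {suc (suc i)} {suc (suc j)} _ (s≤s j≤i) =
  cong (x ∷_) (removeAt-removeAt L (s≤s z≤n) j≤i)

length-nabla : ∀ L r → ValidPos L r → length L ≡ suc (length (nabla r L))
length-nabla L r vr =
  trans (length-removeAt L r vr) (cong suc (sym (length-map (std (at L r)) (removeAt L r))))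

at-nabla : ∀ L r p → at (nabla r L) p ≡ std (at L r) (at (removeAt L r) p)
at-nabla L r p = at-map (std (at L r)) refl (removeAt L r) p

at-nabla-< : ∀ L {r p} → 1 ≤ p → p < r → at (nabla r L) p ≡ std (at L r) (at L p)
at-nabla-< L {r} {p} 1≤p p<r =
  trans (at-nabla L r p) (cong (std (at L r)) (at-removeAt-< L 1≤p p<r))

at-nabla-≥ : ∀ L {r p} → 1 ≤ r → r ≤ p → at (nabla r L) p ≡ std (at L r) (at L (suc p))
at-nabla-≥ L {r} {p} 1≤r r≤p =
  trans (at-nabla L r p) (cong (std (at L r)) (at-removeAt-≥ L 1≤r r≤p))

ValidPos-nabla : ∀ L r s → ValidPos L r → 1 ≤ s → s < length L → ValidPos (nabla r L) s
ValidPos-nabla L r s vr 1≤s s<len = 1≤s , ≤-pred (subst (suc s ≤_) (length-nabla L r vr) s<len)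

nabla-comm : ∀ L {i j} → 1 ≤ j → j ≤ i → at L (suc i) ≢ at L j →
             nabla j (nabla (suc i) L) ≡ nabla i (nabla j L)
nabla-comm L {i} {j} 1≤j j≤i v≢w = begin
    map (std (at (nabla (suc i) L) j)) (removeAt (map (std v) (removeAt L (suc i))) j)
  ≡⟨ cong₂ (λ u → map (std u)) (at-nabla-< L 1≤j (s≤s j≤i))
           (removeAt-map (std v) (removeAt L (suc i)) j) ⟩
    map (std (std v w)) (map (std v) (removeAt (removeAt L (suc i)) j))
  ≡⟨ sym (map-∘ (removeAt (removeAt L (suc i)) j)) ⟩
    map (λ x → std (std v w) (std v x)) (removeAt (removeAt L (suc i)) j)
  ≡⟨ cong (map _) (removeAt-removeAt L 1≤j j≤i) ⟩
    map (λ x → std (std v w) (std v x)) (removeAt (removeAt L j) i)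
  ≡⟨ map-cong (std-comm v≢w) (removeAt (removeAt L j) i) ⟩
    map (λ x → std (std w v) (std w x)) (removeAt (removeAt L j) i)
  ≡⟨ map-∘ (removeAt (removeAt L j) i) ⟩
    map (std (std w v)) (map (std w) (removeAt (removeAt L j) i))
  ≡⟨ cong₂ (λ u → map (std u)) (at-nabla-≥ L 1≤j j≤i) (removeAt-map (std w) (removeAt L j) i) ⟨
    map (std (at (nabla j L) i)) (removeAt (map (std w) (removeAt L j)) i)
  ∎
  where
  open ≡-Reasoning
  v = at L (suc i)
  w = at L j

IsPerm⇒Unique : ∀ {n σ} → IsPerm n σ → Unique σ
IsPerm⇒Unique {n} σ↭ =
  Unique-resp-↭ (↭⇒↭ₛ (↭-sym σ↭)) (Unique.map⁺ suc-injective (Unique.upTo⁺ n))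

Unique⇒at-injective : ∀ {L} → Unique L → ∀ {p q} → ValidPos L p → ValidPos L q →
                      at L p ≡ at L q → p ≡ q
Unique⇒at-injective {[]} _ {suc p} (_ , ()) _ _
Unique⇒at-injective {x ∷ L} _ {suc zero} {suc zero} _ _ _ = refl
Unique⇒at-injective {x ∷ L} (x∉L ∷ _) {suc zero} {suc (suc q)} _ (_ , s≤s q<) x≡ =
  contradiction x≡ (All.lookup x∉L (at-∈ L (suc q) (s≤s z≤n , q<)))
Unique⇒at-injective {x ∷ L} (x∉L ∷ _) {suc (suc p)} {suc zero} (_ , s≤s p<) _ ≡x =
  contradiction (sym ≡x) (All.lookup x∉L (at-∈ L (suc p) (s≤s z≤n , p<)))
Unique⇒at-injective {x ∷ L} (_ ∷ uL) {suc (suc p)} {suc (suc q)} (_ , s≤s p<) (_ , s≤s q<) e =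
  cong suc (Unique⇒at-injective uL (s≤s z≤n , p<) (s≤s z≤n , q<) e)

Unique⇒at-≢ : ∀ {L} → Unique L → ∀ {p q} → ValidPos L p → ValidPos L q →
              p ≢ q → at L p ≢ at L q
Unique⇒at-≢ uL vp vq p≢q e = p≢q (Unique⇒at-injective uL vp vq e)

interval : ℕ → ℕ → List ℕ
interval a zero = []
interval a (suc k) = a ∷ interval (suc a) k

map-suc-interval : ∀ a k → map suc (interval a k) ≡ interval (suc a) k
map-suc-interval a zero = refl
map-suc-interval a (suc k) = cong (suc a ∷_) (map-suc-interval (suc a) k)

upTo≡interval : ∀ n → upTo n ≡ interval 0 n
upTo≡interval zero = refl
upTo≡interval (suc n) = cong (0 ∷_) (begin
    applyUpTo suc n       ≡⟨ sym (map-upTo suc n) ⟩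
    map suc (upTo n)       ≡⟨ cong (map suc) (upTo≡interval n) ⟩
    map suc (interval 0 n) ≡⟨ map-suc-interval 0 n ⟩
    interval 1 n           ∎)
  where open ≡-Reasoning

map-suc-upTo≡interval : ∀ n → map suc (upTo n) ≡ interval 1 n
map-suc-upTo≡interval n = trans (cong (map suc) (upTo≡interval n)) (map-suc-interval 0 n)

interval-++ : ∀ a k m → interval a (k + m) ≡ interval a k ++ interval (a + k) m
interval-++ a zero m = cong (λ b → interval b m) (sym (+-identityʳ a))
interval-++ a (suc k) m = cong (a ∷_) (trans (interval-++ (suc a) k m)
  (cong (λ b → interval (suc a) k ++ interval b m) (sym (+-suc a k))))

∈-interval : ∀ {x} a k → x ∈ interval a k → a ≤ x × x < a + k
∈-interval a (suc k) (here refl) = ≤-refl , m<m+n a z<s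
∈-interval {x} a (suc k) (there x∈) with ∈-interval (suc a) k x∈
... | a<x , x<1+a+k = <⇒≤ a<x , subst (λ b → x < b) (sym (+-suc a k)) x<1+a+k

map-std-interval-≤ : ∀ {v} a k → a + k ≤ suc v → map (std v) (interval a k) ≡ interval a k
map-std-interval-≤ a zero _ = refl
map-std-interval-≤ {v} a (suc k) a+1+k≤1+v =
  cong₂ _∷_ (std-≤ (≤-pred (≤-trans (s≤s (m≤m+n a k)) 1+a+k≤1+v)))
            (map-std-interval-≤ (suc a) k 1+a+k≤1+v)
  where
  1+a+k≤1+v : suc a + k ≤ suc v
  1+a+k≤1+v = subst (λ b → b ≤ suc v) (+-suc a k) a+1+k≤1+v

map-std-interval-suc : ∀ {v} a k → v ≤ a → map (std v) (interval (suc a) k) ≡ interval a k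
map-std-interval-suc a zero _ = refl
map-std-interval-suc a (suc k) v≤a =
  cong₂ _∷_ (std-suc v≤a) (map-std-interval-suc (suc a) k (m≤n⇒m≤1+n v≤a))

standardize-↭-interval : ∀ v xs n → v ∷ xs ↭ interval 1 n →
                         standardize v xs ↭ interval 1 (n ∸ 1)
standardize-↭-interval v xs n v∷xs↭ with ∈-interval 1 n (∈-resp-↭ v∷xs↭ (here refl))
standardize-↭-interval (suc u) xs n v∷xs↭ | _ , s≤s v≤n with m≤n⇒∃[o]m+o≡n v≤n
... | m , refl = begin
    map (std (suc u)) xs
      ↭⟨ map⁺ (std (suc u)) xs↭ ⟩
    map (std (suc u)) (interval 1 u ++ interval (suc (suc u)) m)
      ≡⟨ map-++ (std (suc u)) (interval 1 u) _ ⟩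
    map (std (suc u)) (interval 1 u) ++ map (std (suc u)) (interval (suc (suc u)) m)
      ≡⟨ cong₂ _++_ (map-std-interval-≤ 1 u (n≤1+n _)) (map-std-interval-suc (suc u) m ≤-refl) ⟩
    interval 1 u ++ interval (suc u) m
      ≡⟨ interval-++ 1 u m ⟨
    interval 1 (u + m)
      ∎
  where
  open PermutationReasoning
  xs↭ : xs ↭ interval 1 u ++ interval (suc (suc u)) m
  xs↭ = drop-mid [] (interval 1 u)
    (↭-trans v∷xs↭ (↭-reflexive
      (trans (cong (interval 1) (sym (+-suc u m))) (interval-++ 1 u (suc m)))))

IsPerm⇒length : ∀ {n σ} → IsPerm n σ → length σ ≡ n
IsPerm⇒length {n} σ↭ = trans (↭-length σ↭) (trans (length-map suc (upTo n)) (length-upTo n))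

IsPerm-nabla : ∀ {n} σ r → IsPerm n σ → ValidPos σ r → IsPerm (n ∸ 1) (nabla r σ)
IsPerm-nabla {n} σ r σ↭ vr = ↭-trans
  (standardize-↭-interval (at σ r) (removeAt σ r) n
    (↭-trans (↭-sym (removeAt-↭ σ r vr)) (↭-trans σ↭ (↭-reflexive (map-suc-upTo≡interval n)))))
  (↭-reflexive (sym (map-suc-upTo≡interval (n ∸ 1))))

Adj? : ∀ a b → Dec (Adj a b)
Adj? a b = (suc a ≟ b) ⊎-dec (suc b ≟ a)

Block : List ℕ → ℕ → Set
Block L p = 1 ≤ p × suc p ≤ length L × Adj (at L p) (at L (suc p))

Block⇒¬IsKing : ∀ L p → Block L p → ¬ IsKing L
Block⇒¬IsKing (a ∷ []) (suc zero) (_ , s≤s () , _)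
Block⇒¬IsKing (a ∷ b ∷ L) (suc zero) (_ , _ , adj) (¬adj , _) = ¬adj adj
Block⇒¬IsKing (a ∷ b ∷ L) (suc (suc p)) (_ , s≤s p< , adj) (_ , king) =
  Block⇒¬IsKing (b ∷ L) (suc p) (s≤s z≤n , p< , adj) king

Block-∷ : ∀ {a L} → ∃ (Block L) → ∃ (Block (a ∷ L))
Block-∷ (suc p , _ , p< , adj) = suc (suc p) , s≤s z≤n , s≤s p< , adj

¬IsKing⇒Block : ∀ L → ¬ IsKing L → ∃ (Block L)
¬IsKing⇒Block [] ¬king = contradiction _ ¬king
¬IsKing⇒Block (a ∷ []) ¬king = contradiction _ ¬king
¬IsKing⇒Block (a ∷ b ∷ L) ¬king =
  first-or-later (Adj? a b) (λ ¬adj → ¬IsKing⇒Block (b ∷ L) (λ king → ¬king (¬adj , king)))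
  where
  first-or-later : Dec (Adj a b) → (¬ Adj a b → ∃ (Block (b ∷ L))) → ∃ (Block (a ∷ b ∷ L))
  first-or-later (yes adj) _ = 1 , s≤s z≤n , s≤s (s≤s z≤n) , adj
  first-or-later (no ¬adj) later = Block-∷ (later ¬adj)

std-preserves-Adj-at : ∀ L r p → Unique L → ValidPos L r → 1 ≤ p → suc p ≤ length L →
  r ≢ p → r ≢ suc p →
  Adj (at L p) (at L (suc p)) → Adj (std (at L r) (at L p)) (std (at L r) (at L (suc p)))
std-preserves-Adj-at L r p uL vr 1≤p 1+p≤len r≢p r≢1+p = std-preserves-Adj
  (Unique⇒at-≢ uL (1≤p , ≤-trans (n≤1+n p) 1+p≤len) vr (≢-sym r≢p))
  (Unique⇒at-≢ uL (s≤s z≤n , 1+p≤len) vr (≢-sym r≢1+p))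

Block-survives-nabla : ∀ L r p → Unique L → ValidPos L r → Block L p → r ≢ p → r ≢ suc p →
  ∃ (Block (nabla r L))
Block-survives-nabla L r p uL vr@(1≤r , r≤len) (1≤p , 1+p≤len , adj) r≢p r≢1+p with <-cmp r p
... | tri≈ _ r≡p _ = contradiction r≡p r≢p
Block-survives-nabla L r (suc p) uL vr@(1≤r , r≤len) (1≤p , 1+p≤len , adj) r≢p r≢1+p
  | tri< (s≤s r≤p) _ _ =
  p , ≤-trans 1≤r r≤p , ≤-pred (subst (_ ≤_) (length-nabla L r vr) 1+p≤len) ,
  subst₂ Adj (sym (at-nabla-≥ L 1≤r r≤p)) (sym (at-nabla-≥ L 1≤r (m≤n⇒m≤1+n r≤p)))
    (std-preserves-Adj-at L r (suc p) uL vr 1≤p 1+p≤len r≢p r≢1+p adj)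
... | tri> _ _ p<r =
  p , 1≤p , ≤-pred (subst (_ ≤_) (length-nabla L r vr) (≤-trans 1+p<r r≤len)) ,
  subst₂ Adj (sym (at-nabla-< L 1≤p p<r)) (sym (at-nabla-< L (s≤s z≤n) 1+p<r))
    (std-preserves-Adj-at L r p uL vr 1≤p 1+p≤len r≢p r≢1+p adj)
  where
  1+p<r : suc p < r
  1+p<r = ≤∧≢⇒< p<r (≢-sym r≢1+p)

nabla-breaks-Block : ∀ L r p → Unique L → ValidPos L r → Block L p → IsKing (nabla r L) →
                     r ≡ p ⊎ r ≡ suc p
nabla-breaks-Block L r p uL vr B king with r ≟ p | r ≟ suc p
... | yes r≡p | _ = inj₁ r≡p
... | no _ | yes r≡1+p = inj₂ r≡1+p
... | no r≢p | no r≢1+p =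
  contradiction king (uncurry (Block⇒¬IsKing (nabla r L)) (Block-survives-nabla L r p uL vr B r≢p r≢1+p))

-- liftPos r p is the position in σ of the entry at position p of ∇_r σ.
liftPos : ℕ → ℕ → ℕ
liftPos zero p = suc p
liftPos (suc r) zero = zero
liftPos (suc r) (suc p) = suc (liftPos r p)

liftPos-< : ∀ {r p} → p < r → liftPos r p ≡ p
liftPos-< {suc r} {zero} _ = refl
liftPos-< {suc r} {suc p} (s≤s p<r) = cong suc (liftPos-< p<r)

liftPos-≥ : ∀ {r p} → r ≤ p → liftPos r p ≡ suc p
liftPos-≥ {zero} _ = refl
liftPos-≥ {suc r} {suc p} (s≤s r≤p) = cong suc (liftPos-≥ r≤p)

Separates-sym : ∀ σ r a b → Separates σ r a b → Separates σ r b a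
Separates-sym σ r a b (inj₁ (inj₁ (a→r , r→b) , adj)) = inj₁ (inj₂ (a→r , r→b) , Adj-sym adj)
Separates-sym σ r a b (inj₁ (inj₂ (b→r , r→a) , adj)) = inj₁ (inj₁ (b→r , r→a) , Adj-sym adj)
Separates-sym σ r a b (inj₂ (inj₁ cons , adj)) = inj₂ (inj₂ cons , Adj-sym adj)
Separates-sym σ r a b (inj₂ (inj₂ cons , adj)) = inj₂ (inj₁ cons , Adj-sym adj)

horizontal-Separates : ∀ σ r q → IsKing σ → Unique σ → ValidPos σ r → 1 ≤ q → suc q ≤ length σ →
  r ≢ q → r ≢ suc q → Adj (std (at σ r) (at σ q)) (std (at σ r) (at σ (suc q))) →
  Separates σ r q (suc q)
horizontal-Separates σ r q king uσ vr 1≤q 1+q≤len r≢q r≢1+q adj = separate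
  (std-reflects-Adj (Unique⇒at-≢ uσ (1≤q , ≤-trans (n≤1+n q) 1+q≤len) vr (≢-sym r≢q))
                    (Unique⇒at-≢ uσ (s≤s z≤n , 1+q≤len) vr (≢-sym r≢1+q)) adj)
  where
  separate : Adj (at σ q) (at σ (suc q)) ⊎ Consecutive (at σ q) (at σ r) (at σ (suc q)) →
             Separates σ r q (suc q)
  separate (inj₁ adj′) = contradiction king (Block⇒¬IsKing σ q (1≤q , 1+q≤len , adj′))
  separate (inj₂ cons) = inj₂ (cons , inj₁ refl)

vertical-Separates : ∀ σ q → IsKing σ → Unique σ → 1 ≤ q → suc (suc q) ≤ length σ →
  Adj (std (at σ (suc q)) (at σ q)) (std (at σ (suc q)) (at σ (suc (suc q)))) →
  Separates σ (suc q) q (suc (suc q))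
vertical-Separates σ q king uσ 1≤q 2+q≤len adj = separate
  (std-reflects-Adj
    (Unique⇒at-≢ uσ (1≤q , ≤-trans (n≤1+n q) 1+q≤len) (s≤s z≤n , 1+q≤len) (<⇒≢ (n<1+n q)))
    (Unique⇒at-≢ uσ (s≤s z≤n , 2+q≤len) (s≤s z≤n , 1+q≤len) (>⇒≢ (n<1+n (suc q)))) adj)
  where
  1+q≤len : suc q ≤ length σ
  1+q≤len = ≤-trans (n≤1+n (suc q)) 2+q≤len
  separate : Adj (at σ q) (at σ (suc (suc q))) ⊎
             Consecutive (at σ q) (at σ (suc q)) (at σ (suc (suc q))) →
             Separates σ (suc q) q (suc (suc q))
  separate (inj₁ adj′) = inj₁ (inj₁ (refl , refl) , adj′)
  separate (inj₂ (inj₁ (1+a≡v , _))) =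
    contradiction king (Block⇒¬IsKing σ q (1≤q , 1+q≤len , inj₁ 1+a≡v))
  separate (inj₂ (inj₂ (_ , 1+v≡a))) =
    contradiction king (Block⇒¬IsKing σ q (1≤q , 1+q≤len , inj₂ 1+v≡a))

Block-nabla⇒Separates : ∀ σ r p → IsKing σ → Unique σ → ValidPos σ r → Block (nabla r σ) p →
  ValidPos σ (liftPos r p) × ValidPos σ (liftPos r (suc p)) ×
  Separates σ r (liftPos r p) (liftPos r (suc p))
Block-nabla⇒Separates σ r p king uσ vr@(1≤r , r≤len) (1≤p , 1+p≤len′ , adj) with <-cmp (suc p) r
... | tri< 2+p≤r _ _ rewrite liftPos-< (<⇒≤ 2+p≤r) | liftPos-< 2+p≤r =
  (1≤p , ≤-trans (n≤1+n p) 1+p≤len) , (s≤s z≤n , 1+p≤len) ,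
  horizontal-Separates σ r p king uσ vr 1≤p 1+p≤len (>⇒≢ (<⇒≤ 2+p≤r)) (>⇒≢ 2+p≤r)
    (subst₂ Adj (at-nabla-< σ 1≤p (<⇒≤ 2+p≤r)) (at-nabla-< σ (s≤s z≤n) 2+p≤r) adj)
  where
  1+p≤len : suc p ≤ length σ
  1+p≤len = ≤-trans (<⇒≤ 2+p≤r) r≤len
Block-nabla⇒Separates σ .(suc p) p king uσ vr@(_ , r≤len) (1≤p , 1+p≤len′ , adj) | tri≈ _ refl _
  rewrite liftPos-< (n<1+n p) | liftPos-≥ (≤-refl {suc p}) =
  (1≤p , ≤-trans (n≤1+n p) r≤len) , (s≤s z≤n , 2+p≤len) ,
  vertical-Separates σ p king uσ 1≤p 2+p≤len
    (subst₂ Adj (at-nabla-< σ 1≤p ≤-refl) (at-nabla-≥ σ (s≤s z≤n) ≤-refl) adj)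
  where
  2+p≤len : suc (suc p) ≤ length σ
  2+p≤len = subst (suc (suc p) ≤_) (sym (length-nabla σ (suc p) vr)) (s≤s 1+p≤len′)
... | tri> _ _ (s≤s r≤p) rewrite liftPos-≥ r≤p | liftPos-≥ (m≤n⇒m≤1+n r≤p) =
  (s≤s z≤n , ≤-trans (n≤1+n _) 2+p≤len) , (s≤s z≤n , 2+p≤len) ,
  horizontal-Separates σ r (suc p) king uσ vr (s≤s z≤n) 2+p≤len
    (<⇒≢ (s≤s r≤p)) (<⇒≢ (s≤s (m≤n⇒m≤1+n r≤p)))
    (subst₂ Adj (at-nabla-≥ σ 1≤r r≤p) (at-nabla-≥ σ 1≤r (m≤n⇒m≤1+n r≤p)) adj)
  where
  2+p≤len : suc (suc p) ≤ length σ
  2+p≤len = subst (suc (suc p) ≤_) (sym (length-nabla σ r vr)) (s≤s 1+p≤len′)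

Block-nabla⇒SeparatesFromSome : ∀ σ r p s → IsKing σ → Unique σ → ValidPos σ r →
  Block (nabla r σ) p → s ≡ p ⊎ s ≡ suc p → SeparatesFromSome σ r (liftPos r s)
Block-nabla⇒SeparatesFromSome σ r p s king uσ vr B s∈block
  with Block-nabla⇒Separates σ r p king uσ vr B
Block-nabla⇒SeparatesFromSome σ r p .p king uσ vr B (inj₁ refl) | _ , v₂ , sep =
  liftPos r (suc p) , v₂ , sep
Block-nabla⇒SeparatesFromSome σ r p .(suc p) king uσ vr B (inj₂ refl) | v₁ , _ , sep =
  liftPos r p , v₁ , Separates-sym σ r (liftPos r p) (liftPos r (suc p)) sep

king-nabla-nabla⇒SeparatesFromSome : ∀ {n} σ r s → InK n σ → ValidPos σ r →
  ¬ IsKing (nabla r σ) → ValidPos (nabla r σ) s → IsKing (nabla s (nabla r σ)) →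
  SeparatesFromSome σ r (liftPos r s)
king-nabla-nabla⇒SeparatesFromSome σ r s (σ-perm , σ-king) vr ¬king vs king₂
  with ¬IsKing⇒Block (nabla r σ) ¬king
... | p , B = Block-nabla⇒SeparatesFromSome σ r p s σ-king (IsPerm⇒Unique σ-perm) vr B
  (nabla-breaks-Block (nabla r σ) s p (IsPerm⇒Unique (IsPerm-nabla σ r σ-perm vr)) vs B king₂)

mainTheorem2 : (n : ℕ) (σ : List ℕ) (i j : ℕ) →
    InK n σ → 1 ≤ j → j < i → i ≤ n →
    InK (n ∸ 2) (nabla j (nabla i σ)) →
    ¬ InK (n ∸ 1) (nabla i σ) → ¬ InK (n ∸ 1) (nabla j σ) →
    SeparatesFromSome σ i j × SeparatesFromSome σ j i
mainTheorem2 n σ (suc i) j σ∈K 1≤j j<1+i@(s≤s j≤i) 1+i≤n (_ , ∇ⱼ∇ᵢσ-king) ∇ᵢσ∉K ∇ⱼσ∉K =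
  subst (SeparatesFromSome σ (suc i)) (liftPos-< j<1+i)
    (king-nabla-nabla⇒SeparatesFromSome σ (suc i) j σ∈K vᵢ (¬IsKing vᵢ ∇ᵢσ∉K)
      (ValidPos-nabla σ (suc i) j vᵢ 1≤j (≤-trans j<1+i 1+i≤len)) ∇ⱼ∇ᵢσ-king) ,
  subst (SeparatesFromSome σ j) (liftPos-≥ j≤i)
    (king-nabla-nabla⇒SeparatesFromSome σ j i σ∈K vⱼ (¬IsKing vⱼ ∇ⱼσ∉K)
      (ValidPos-nabla σ j i vⱼ (≤-trans 1≤j j≤i) 1+i≤len)
      (subst IsKing (nabla-comm σ 1≤j j≤i σᵢ≢σⱼ) ∇ⱼ∇ᵢσ-king))
  where
  1+i≤len : suc i ≤ length σ
  1+i≤len = subst (suc i ≤_) (sym (IsPerm⇒length (proj₁ σ∈K))) 1+i≤n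
  vᵢ : ValidPos σ (suc i)
  vᵢ = s≤s z≤n , 1+i≤len
  vⱼ : ValidPos σ j
  vⱼ = 1≤j , ≤-trans (m≤n⇒m≤1+n j≤i) 1+i≤len
  σᵢ≢σⱼ : at σ (suc i) ≢ at σ j
  σᵢ≢σⱼ = Unique⇒at-≢ (IsPerm⇒Unique (proj₁ σ∈K)) vᵢ vⱼ (>⇒≢ j<1+i)
  ¬IsKing : ∀ {r} → ValidPos σ r → ¬ InK (n ∸ 1) (nabla r σ) → ¬ IsKing (nabla r σ)
  ¬IsKing {r} vr ∇ᵣσ∉K king = ∇ᵣσ∉K (IsPerm-nabla σ r (proj₁ σ∈K) vr , king)
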